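{- (i) For $n\ge1$, the $n$-cycle $\mathsf C_n$ satisfies $\iota(\mathsf C_n)=\frac n4$ if $n$ is even and $\iota(\mathsf C_n)=\frac{n^2-1}{4n}$ if $n$ is odd. (ii) For $n\ge 2$ and $d\ge1$, the $d$-torus $\mathsf C_n^{\Box d}$ satisfies $\iota(\mathsf C_n^{\Box d})=\frac{dn}{4}$ if $n$ is even and $\frac{d(n^2-1)}{4n}$ if $n$ is odd. (iii) For $d\ge2$, the $d$-cube graph $\mathsf Q_d=\mathsf K_2^{\Box d}$ satisfies $\iota(\mathsf Q_d)=\frac d2$. (iv) For $n,m\ge1$, the rectangular lattice satisfies $\iota(\mathsf P_n\Box\mathsf P_m)=\frac{n-1}{2}+\frac{m-1}{2}$. (v) For $n\ge1$, the complete graph satisfies $\iota(\mathsf K_n)=\frac{n-1}{n}$.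
   Context: All graphs are finite, simple, undirected. For a connected graph $G$ with vertices $v_1,\dots,v_n$, $D=(d(v_i,v_j))_{i,j}$ is its shortest-path distance matrix and $\vec 1$ the all-ones vector. A curvature potential is a vector $\vec x$ with $D\vec x=\vec 1$; $G$ is distance exceptional if it has no curvature potential. Let $X(G)=\{D\vec x:\vec x\in\mathbb{R}^n,\ \vec x^\top\vec 1=1\}$. If $G$ is distance exceptional or has a curvature potential $\vec x$ with $\vec 1^\top\vec x\ne 0$, then $X(G)\cap\mathbb{R}\vec 1$ is a single point, and the curvature index $\iota(G)\in\mathbb{R}$ is defined by $X(G)\cap\mathbb{R}\vec 1=\{\iota(G)\vec 1\}$; otherwise $\iota(G):=\infty$. $\mathsf P_n$ is the path on $n$ vertices, $\mathsf K_n$ the complete graph. The Cartesian product $G\Box H$ has vertex set $V(G)\times V(H)$ with $(u,v)\sim(u',v')$ iff ($u=u'$ and $v\sim v'$ in $H$) or ($v=v'$ and $u\sim u'$ in $G$); $G^{\Box d}$ is the $d$-fold Cartesian power.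
   Formalization: Curvature potentials, the vectors $\vec x$ defining $X(G)$, and the candidate values of $\iota(G)$ are taken over ℚ instead of ℝ, also in the definition of distance exceptional. -}

module Defs where

open import Data.Bool using (Bool; true; false; _∧_; _∨_; not; if_then_else_)
open import Data.Nat as ℕ using (ℕ; zero; suc; _≡ᵇ_; _%_)
open import Data.Fin as Fin using (Fin; toℕ; combine; remQuot)
open import Data.Product using (Σ; _×_; _,_; proj₁; proj₂)
open import Data.Sum using (_⊎_)
open import Data.Integer using (+_)
open import Data.Rational as ℚ using (ℚ; _/_; 0ℚ; 1ℚ; _*_; _+_)
open import Relation.Binary.PropositionalEquality using (_≡_; _≢_)
open import Relation.Nullary using (¬_)

record Graph : Set where
  field
    size : ℕ
    adj  : Fin size → Fin size → Bool
open Graph public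

finEq : ∀ {n} → Fin n → Fin n → Bool
finEq i j = toℕ i ≡ᵇ toℕ j

anyFin : ∀ {n} → (Fin n → Bool) → Bool
anyFin {zero}  f = false
anyFin {suc n} f = f Fin.zero ∨ anyFin (λ i → f (Fin.suc i))

reach : (G : Graph) → ℕ → Fin (size G) → Fin (size G) → Bool
reach G zero    u v = finEq u v
reach G (suc k) u v = reach G k u v ∨ anyFin (λ w → reach G k u w ∧ adj G w v)

-- least k ≤ b with f k = true (returns b if there is none)
search : (ℕ → Bool) → ℕ → ℕ
search f zero    = zero
search f (suc b) = if f zero then zero else suc (search (λ k → f (suc k)) b)

-- shortest-path distance (for a connected graph on N vertices the
-- distance is < N, so the search bound N is never reached).
dist : (G : Graph) → Fin (size G) → Fin (size G) → ℕ
dist G u v = search (λ k → reach G k u v) (size G)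

Dmat : (G : Graph) → Fin (size G) → Fin (size G) → ℚ
Dmat G i j = + dist G i j / 1

∑ : ∀ {n} → (Fin n → ℚ) → ℚ
∑ {zero}  f = 0ℚ
∑ {suc n} f = f Fin.zero + ∑ (λ i → f (Fin.suc i))

Dmul : (G : Graph) → (Fin (size G) → ℚ) → Fin (size G) → ℚ
Dmul G x i = ∑ (λ j → Dmat G i j * x j)

IsCurvaturePotential : (G : Graph) → (Fin (size G) → ℚ) → Set
IsCurvaturePotential G x = ∀ i → Dmul G x i ≡ 1ℚ

DistanceExceptional : Graph → Set
DistanceExceptional G = ¬ (Σ (Fin (size G) → ℚ) (IsCurvaturePotential G))

-- c·1 ∈ X(G) = { D x : 1ᵀx = 1 }
ConstInX : (G : Graph) → ℚ → Set
ConstInX G c = Σ (Fin (size G) → ℚ) λ x → (∑ x ≡ 1ℚ) × (∀ i → Dmul G x i ≡ c)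

-- ι(G) = c (finite value): G is distance exceptional or has a curvature
-- potential with nonzero coordinate sum, and X(G) ∩ ℝ1 = {c·1}.
CurvatureIndexIs : Graph → ℚ → Set
CurvatureIndexIs G c =
  (DistanceExceptional G
     ⊎ Σ (Fin (size G) → ℚ) (λ x → IsCurvaturePotential G x × (∑ x ≢ 0ℚ)))
  × ConstInX G c
  × (∀ c' → ConstInX G c' → c' ≡ c)

K : ℕ → Graph
K n = record { size = n ; adj = λ i j → not (finEq i j) }

P : ℕ → Graph
P n = record { size = n ; adj = λ i j →
        (suc (toℕ i) ≡ᵇ toℕ j) ∨ (suc (toℕ j) ≡ᵇ toℕ i) }

-- cycle C_n : i ~ j iff i ≠ j and j ≡ i+1 or i ≡ j+1 (mod n)
-- (so C_1 = K_1, C_2 = K_2 as simple graphs)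
C : ℕ → Graph
C zero    = K zero
C (suc k) = record { size = suc k ; adj = λ i j → not (finEq i j) ∧
        ((suc (toℕ i) % suc k ≡ᵇ toℕ j) ∨ (suc (toℕ j) % suc k ≡ᵇ toℕ i)) }

-- Cartesian product G □ H, vertex (u , v) encoded as combine u v
_□_ : Graph → Graph → Graph
G □ H = record { size = size G ℕ.* size H ; adj = λ a b →
          let u = proj₁ (remQuot {size G} (size H) a) ; v = proj₂ (remQuot {size G} (size H) a)
              u' = proj₁ (remQuot {size G} (size H) b) ; v' = proj₂ (remQuot {size G} (size H) b)
          in (finEq u u' ∧ adj H v v') ∨ (finEq v v' ∧ adj G u u') }

_^□_ : Graph → ℕ → Graph
G ^□ zero  = K 1
G ^□ suc d = G □ (G ^□ d)

Q : ℕ → Graph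
Q d = K 2 ^□ d

-- a // b = a / b as a rational (junk value 0 when b = 0)
_//_ : ℕ → ℕ → ℚ
a // zero  = 0ℚ
a // suc b = + a / suc b

-- Since D is symmetric, vectors x and y with 1ᵀx = 1ᵀy = 1, D x = a 1 and D y = b 1 give
-- b = xᵀ D y = yᵀ D x = a, so ι(G) is the value a of any single such x; when a ≠ 0, x / a is a
-- curvature potential with coordinate sum 1 / a, and a graph with one vertex is distance exceptional.
-- For K_n and C_n every row of D has the same sum R (n - 1, resp. ⌊n²/4⌋), so the uniform x gives
-- a = R / n; for P_n, weight 1/2 on both ends gives a = (n - 1)/2 because the distances to the two
-- ends add up to n - 1; distances in G □ H add, so the product of such vectors gives a_G + a_H.
-- The shortest-path distance of the definitions is a bounded search over walks; it is identified with
-- an explicit formula δ through a certificate: δ vanishes exactly on the diagonal, grows by at most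
-- one along an edge, and decreases along some edge into every other vertex.

module Submission where

open import Defs
open import Data.Nat.Divisibility using (_∣_; divides; m%n≡0⇒n∣m)
open import Relation.Nullary using (¬_; yes; no)
open import Data.Rational using () renaming (_+_ to _+ℚ_)

open import Algebra.Bundles using (Ring)
open import Algebra.Properties.Semiring.Sum as Sum using ()
open import Data.Bool using (Bool; true; false; T; _∧_; _∨_; not; if_then_else_)
open import Data.Bool.Properties using (T-∨; T-∧; T-≡; T-not-≡)
open import Data.Empty using (⊥-elim)
open import Data.Fin as Fin using (Fin; zero; suc; toℕ; _↑ˡ_; _↑ʳ_)
open import Data.Fin.Properties using (toℕ<n; toℕ-injective; toℕ-fromℕ<; toℕ-fromℕ; remQuot-combine; combine-remQuot)
open import Data.Integer as ℤ using (+_)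
import Data.Integer.Properties as ℤP
open import Data.Nat as ℕ using (ℕ; zero; suc; _≤_; _<_; z≤n; s≤s; _≡ᵇ_; ∣_-_∣; _⊓_; _∸_; _%_; _*_)
import Data.Nat.DivMod as DM
import Data.Nat.Properties as ℕP
open import Data.Product using (Σ; ∃-syntax; _×_; _,_; proj₁; proj₂)
open import Data.Rational as ℚ using (ℚ; _/_; 0ℚ; 1ℚ; toℚᵘ; fromℚᵘ)
import Data.Rational.Properties as ℚP
open import Data.Rational.Solver using (module +-*-Solver)
open import Data.Nat.Solver using () renaming (module +-*-Solver to ℕ-Solver)
open import Data.Rational.Unnormalised as ℚᵘ using (mkℚᵘ; 0ℚᵘ; *≡*)
import Data.Rational.Unnormalised.Properties as ℚᵘP
open import Data.Sum using (_⊎_; inj₁; inj₂; map₂)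
open import Function using (_∘_; Equivalence)
open import Relation.Binary.Definitions using (tri<; tri≈; tri>)
open import Relation.Binary.PropositionalEquality

open Equivalence using (to; from)

fromℕ : ℕ → ℚ
fromℕ n = + n / 1

fromℚᵘ-homo-+ : ∀ p q → fromℚᵘ (p ℚᵘ.+ q) ≡ fromℚᵘ p ℚ.+ fromℚᵘ q
fromℚᵘ-homo-+ p q = trans (ℚP.fromℚᵘ-cong (ℚᵘP.≃-sym toℚᵘ-sum)) (ℚP.fromℚᵘ-toℚᵘ (fromℚᵘ p ℚ.+ fromℚᵘ q))
  where
  toℚᵘ-sum : toℚᵘ (fromℚᵘ p ℚ.+ fromℚᵘ q) ℚᵘ.≃ p ℚᵘ.+ q
  toℚᵘ-sum = ℚᵘP.≃-trans (ℚP.toℚᵘ-homo-+ (fromℚᵘ p) (fromℚᵘ q))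
                         (ℚᵘP.+-cong (ℚP.toℚᵘ-fromℚᵘ p) (ℚP.toℚᵘ-fromℚᵘ q))

fromℚᵘ-homo-* : ∀ p q → fromℚᵘ (p ℚᵘ.* q) ≡ fromℚᵘ p ℚ.* fromℚᵘ q
fromℚᵘ-homo-* p q = trans (ℚP.fromℚᵘ-cong (ℚᵘP.≃-sym toℚᵘ-product)) (ℚP.fromℚᵘ-toℚᵘ (fromℚᵘ p ℚ.* fromℚᵘ q))
  where
  toℚᵘ-product : toℚᵘ (fromℚᵘ p ℚ.* fromℚᵘ q) ℚᵘ.≃ p ℚᵘ.* q
  toℚᵘ-product = ℚᵘP.≃-trans (ℚP.toℚᵘ-homo-* (fromℚᵘ p) (fromℚᵘ q))
                             (ℚᵘP.*-cong (ℚP.toℚᵘ-fromℚᵘ p) (ℚP.toℚᵘ-fromℚᵘ q))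

/-≡-/ : ∀ a b c d → a ℕ.* suc d ≡ c ℕ.* suc b → + a / suc b ≡ + c / suc d
/-≡-/ a b c d eq = ℚP.fromℚᵘ-cong {mkℚᵘ (+ a) b} {mkℚᵘ (+ c) d} (*≡* (begin
  + a ℤ.* + suc d  ≡⟨ ℤP.pos-* a (suc d) ⟨
  + (a ℕ.* suc d)  ≡⟨ cong +_ eq ⟩
  + (c ℕ.* suc b)  ≡⟨ ℤP.pos-* c (suc b) ⟩
  + c ℤ.* + suc b  ∎))
  where open ≡-Reasoning

//≢0 : ∀ a b .{{_ : ℕ.NonZero a}} .{{_ : ℕ.NonZero b}} → a // b ≢ 0ℚ
//≢0 (suc a) (suc b) eq with ℚP./-injective-≃ (mkℚᵘ (+ suc a) b) 0ℚᵘ eq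
... | *≡* ()

/-+-/ : ∀ a b c d → + a / suc b ℚ.+ + c / suc d ≡ + (a ℕ.* suc d ℕ.+ c ℕ.* suc b) / (suc b ℕ.* suc d)
/-+-/ a b c d = begin
  + a / suc b ℚ.+ + c / suc d                ≡⟨ fromℚᵘ-homo-+ (mkℚᵘ (+ a) b) (mkℚᵘ (+ c) d) ⟨
  fromℚᵘ (mkℚᵘ (+ a) b ℚᵘ.+ mkℚᵘ (+ c) d)  ≡⟨ ℚP./-cong numerator refl ⟩
  + (a ℕ.* suc d ℕ.+ c ℕ.* suc b) / (suc b ℕ.* suc d) ∎
  where
  open ≡-Reasoning
  numerator : + a ℤ.* + suc d ℤ.+ + c ℤ.* + suc b ≡ + (a ℕ.* suc d ℕ.+ c ℕ.* suc b)
  numerator = sym (trans (ℤP.pos-+ (a ℕ.* suc d) (c ℕ.* suc b)) (cong₂ ℤ._+_ (ℤP.pos-* a (suc d)) (ℤP.pos-* c (suc b))))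

/-*-/ : ∀ a b c d → (+ a / suc b) ℚ.* (+ c / suc d) ≡ + (a ℕ.* c) / (suc b ℕ.* suc d)
/-*-/ a b c d = begin
  (+ a / suc b) ℚ.* (+ c / suc d)                ≡⟨ fromℚᵘ-homo-* (mkℚᵘ (+ a) b) (mkℚᵘ (+ c) d) ⟨
  fromℚᵘ (mkℚᵘ (+ a) b ℚᵘ.* mkℚᵘ (+ c) d)  ≡⟨ ℚP./-cong (sym (ℤP.pos-* a c)) refl ⟩
  + (a ℕ.* c) / (suc b ℕ.* suc d)           ∎
  where open ≡-Reasoning

fromℕ-+ : ∀ m n → fromℕ (m ℕ.+ n) ≡ fromℕ m ℚ.+ fromℕ n
fromℕ-+ m n = sym (trans (/-+-/ m 0 n 0) (cong (λ k → + k / 1) (cong₂ ℕ._+_ (ℕP.*-identityʳ m) (ℕP.*-identityʳ n))))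

fromℕ-*-/ : ∀ m a b → fromℕ m ℚ.* (+ a / suc b) ≡ + (m ℕ.* a) / suc b
fromℕ-*-/ m a b = trans (/-*-/ m 0 a b) (ℚP./-cong {+ (m ℕ.* a)} refl (ℕP.+-identityʳ (suc b)))

private module ∑ℚ = Sum (Ring.semiring ℚP.+-*-ring)

∑≡sum : ∀ {n} (f : Fin n → ℚ) → ∑ f ≡ ∑ℚ.sum f
∑≡sum {zero}  f = refl
∑≡sum {suc n} f = cong (f zero ℚ.+_) (∑≡sum (f ∘ suc))

∑-cong : ∀ {n} {f g : Fin n → ℚ} → (∀ i → f i ≡ g i) → ∑ f ≡ ∑ g
∑-cong {f = f} {g} f≗g = trans (∑≡sum f) (trans (∑ℚ.sum-cong-≗ f≗g) (sym (∑≡sum g)))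

∑-distrib-+ : ∀ {n} (f g : Fin n → ℚ) → ∑ (λ i → f i ℚ.+ g i) ≡ ∑ f ℚ.+ ∑ g
∑-distrib-+ f g =
  trans (∑≡sum (λ i → f i ℚ.+ g i)) (trans (∑ℚ.∑-distrib-+ f g) (sym (cong₂ ℚ._+_ (∑≡sum f) (∑≡sum g))))

*-distribˡ-∑ : ∀ {n} a (f : Fin n → ℚ) → a ℚ.* ∑ f ≡ ∑ (λ i → a ℚ.* f i)
*-distribˡ-∑ a f = trans (cong (a ℚ.*_) (∑≡sum f)) (trans (∑ℚ.*-distribˡ-sum a f) (sym (∑≡sum (λ i → a ℚ.* f i))))

*-distribʳ-∑ : ∀ {n} a (f : Fin n → ℚ) → ∑ f ℚ.* a ≡ ∑ (λ i → f i ℚ.* a)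
*-distribʳ-∑ a f = trans (cong (ℚ._* a) (∑≡sum f)) (trans (∑ℚ.*-distribʳ-sum a f) (sym (∑≡sum (λ i → f i ℚ.* a))))

∑-zero : ∀ n → ∑ {n} (λ _ → 0ℚ) ≡ 0ℚ
∑-zero n = trans (∑≡sum {n} (λ _ → 0ℚ)) (∑ℚ.sum-replicate-zero n)

∑-comm : ∀ {m n} (f : Fin m → Fin n → ℚ) → ∑ (λ i → ∑ (λ j → f i j)) ≡ ∑ (λ j → ∑ (λ i → f i j))
∑-comm f = trans (∑∑≡sumsum f) (trans (∑ℚ.∑-comm f) (sym (∑∑≡sumsum (λ j i → f i j))))
  where
  ∑∑≡sumsum : ∀ {m n} (g : Fin m → Fin n → ℚ) → ∑ (λ i → ∑ (g i)) ≡ ∑ℚ.sum (λ i → ∑ℚ.sum (g i))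
  ∑∑≡sumsum g = trans (∑-cong (λ i → ∑≡sum (g i))) (∑≡sum (λ i → ∑ℚ.sum (g i)))

∑-↑ : ∀ m n (f : Fin (m ℕ.+ n) → ℚ) → ∑ f ≡ ∑ (λ i → f (i ↑ˡ n)) ℚ.+ ∑ (λ j → f (m ↑ʳ j))
∑-↑ zero    n f = sym (ℚP.+-identityˡ (∑ f))
∑-↑ (suc m) n f = trans (cong (f zero ℚ.+_) (∑-↑ m n (f ∘ suc)))
  (sym (ℚP.+-assoc (f zero) (∑ (λ i → f (suc (i ↑ˡ n)))) (∑ (λ j → f (suc (m ↑ʳ j))))))

∑-combine : ∀ m n (f : Fin (m ℕ.* n) → ℚ) → ∑ f ≡ ∑ {m} (λ u → ∑ {n} (λ v → f (Fin.combine u v)))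
∑-combine zero    n f = refl
∑-combine (suc m) n f =
  trans (∑-↑ n (m ℕ.* n) f) (cong (∑ (λ v → f (v ↑ˡ m ℕ.* n)) ℚ.+_) (∑-combine m n (λ a → f (n ↑ʳ a))))

∑-const : ∀ n q → ∑ {n} (λ _ → q) ≡ fromℕ n ℚ.* q
∑-const zero    q = sym (ℚP.*-zeroˡ q)
∑-const (suc n) q = begin
  q ℚ.+ ∑ {n} (λ _ → q)          ≡⟨ cong₂ ℚ._+_ (sym (ℚP.*-identityˡ q)) (∑-const n q) ⟩
  1ℚ ℚ.* q ℚ.+ fromℕ n ℚ.* q     ≡⟨ ℚP.*-distribʳ-+ q 1ℚ (fromℕ n) ⟨
  (1ℚ ℚ.+ fromℕ n) ℚ.* q         ≡⟨ cong (ℚ._* q) (fromℕ-+ 1 n) ⟨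
  fromℕ (suc n) ℚ.* q            ∎
  where open ≡-Reasoning

∑-indicator : ∀ {n} (w : Fin n) (f : Fin n → ℚ) → ∑ (λ j → if finEq j w then f j else 0ℚ) ≡ f w
∑-indicator {suc n} zero    f = trans (cong (f zero ℚ.+_) (∑-zero n)) (ℚP.+-identityʳ (f zero))
∑-indicator {suc n} (suc w) f =
  trans (ℚP.+-identityˡ (∑ (λ j → if finEq j w then f (suc j) else 0ℚ))) (∑-indicator w (f ∘ suc))

*-if : ∀ a b c → a ℚ.* (if b then c else 0ℚ) ≡ (if b then a ℚ.* c else 0ℚ)
*-if a true  c = refl
*-if a false c = ℚP.*-zeroʳ a

-- Graph distance

≡⇒finEq : ∀ {n} {u v : Fin n} → u ≡ v → T (finEq u v)
≡⇒finEq {u = u} {v} u≡v = ℕP.≡⇒≡ᵇ (toℕ u) (toℕ v) (cong toℕ u≡v)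

finEq⇒≡ : ∀ {n} {u v : Fin n} → T (finEq u v) → u ≡ v
finEq⇒≡ {u = u} {v} h = toℕ-injective (ℕP.≡ᵇ⇒≡ (toℕ u) (toℕ v) h)

≢⇒T-not-≡ᵇ : ∀ {p q} → p ≢ q → T (not (p ≡ᵇ q))
≢⇒T-not-≡ᵇ {p} {q} p≢q with p ≡ᵇ q in eq
... | true  = p≢q (ℕP.≡ᵇ⇒≡ p q (subst T (sym eq) _))
... | false = _

anyFin-witness : ∀ {n} (f : Fin n → Bool) → T (anyFin f) → ∃[ i ] T (f i)
anyFin-witness {suc n} f h with to (T-∨ {f zero} {anyFin (f ∘ suc)}) h
... | inj₁ h₀ = zero , h₀
... | inj₂ h′ with anyFin-witness (f ∘ suc) h′
...   | i , hᵢ = suc i , hᵢ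

anyFin-intro : ∀ {n} (f : Fin n → Bool) i → T (f i) → T (anyFin f)
anyFin-intro f zero    h = from (T-∨ {f zero}) (inj₁ h)
anyFin-intro f (suc i) h = from (T-∨ {f zero}) (inj₂ (anyFin-intro (f ∘ suc) i h))

search-least : ∀ (f : ℕ → Bool) b m → T (f m) → m ≤ b → (∀ k → T (f k) → m ≤ k) → search f b ≡ m
search-least f zero    zero    _  _       _     = refl
search-least f (suc b) m       fm m≤b     least with f zero in f0
... | true  = sym (ℕP.n≤0⇒n≡0 (least 0 (subst T (sym f0) _)))
search-least f (suc b) zero    fm _       least | false = ⊥-elim (subst T f0 fm)
search-least f (suc b) (suc m) fm (s≤s m≤b) least | false =
  cong suc (search-least (f ∘ suc) b m fm m≤b (λ k h → ℕP.≤-pred (least (suc k) h)))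

record DistanceCertificate (G : Graph) : Set where
  field
    δ         : Fin (size G) → Fin (size G) → ℕ
    δ≡0⇒≡     : ∀ {u v} → δ u v ≡ 0 → u ≡ v
    δ-refl    : ∀ u → δ u u ≡ 0
    δ-sym     : ∀ u v → δ u v ≡ δ v u
    δ-edge    : ∀ u {w v} → T (adj G w v) → δ u v ≤ suc (δ u w)
    δ-descent : ∀ u v → δ u v ≢ 0 → ∃[ w ] T (adj G w v) × δ u w < δ u v
    δ<size    : ∀ u v → δ u v < size G

module _ {G : Graph} (c : DistanceCertificate G) where
  open DistanceCertificate c

  reach⇒δ≤ : ∀ k u v → T (reach G k u v) → δ u v ≤ k
  reach⇒δ≤ zero    u v h rewrite finEq⇒≡ {u = u} {v} h | δ-refl v = z≤n
  reach⇒δ≤ (suc k) u v h with to (T-∨ {reach G k u v}) h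
  ... | inj₁ h′ = ℕP.m≤n⇒m≤1+n (reach⇒δ≤ k u v h′)
  ... | inj₂ h′ with anyFin-witness (λ w → reach G k u w ∧ adj G w v) h′
  ...   | w , hw with to (T-∧ {reach G k u w}) hw
  ...     | r , e = ℕP.≤-trans (δ-edge u e) (s≤s (reach⇒δ≤ k u w r))

  δ≤⇒reach : ∀ k u v → δ u v ≤ k → T (reach G k u v)
  δ≤⇒reach zero    u v δ≤0 rewrite δ≡0⇒≡ (ℕP.n≤0⇒n≡0 δ≤0) = ≡⇒finEq {u = v} refl
  δ≤⇒reach (suc k) u v δ≤ with δ u v ℕP.≟ 0
  ... | yes δ≡0 = from (T-∨ {reach G k u v}) (inj₁ (δ≤⇒reach k u v (subst (_≤ k) (sym δ≡0) z≤n)))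
  ... | no  δ≢0 with δ-descent u v δ≢0
  ...   | w , e , closer = from (T-∨ {reach G k u v}) (inj₂ (anyFin-intro (λ w → reach G k u w ∧ adj G w v) w
            (from (T-∧ {reach G k u w}) (δ≤⇒reach k u w (ℕP.≤-pred (ℕP.<-≤-trans closer δ≤)) , e))))

  dist≡δ : ∀ u v → dist G u v ≡ δ u v
  dist≡δ u v = search-least (λ k → reach G k u v) (size G) (δ u v)
    (δ≤⇒reach (δ u v) u v ℕP.≤-refl) (ℕP.<⇒≤ (δ<size u v)) (λ k → reach⇒δ≤ k u v)

  Dmat-sym : ∀ i j → Dmat G i j ≡ Dmat G j i
  Dmat-sym i j = cong fromℕ (trans (dist≡δ i j) (trans (δ-sym i j) (sym (dist≡δ j i))))

-- The curvature index

module _ {G : Graph} (D-sym : ∀ i j → Dmat G i j ≡ Dmat G j i) where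
  open ≡-Reasoning

  ∑-Dmul-sym : ∀ x y → ∑ (λ i → y i ℚ.* Dmul G x i) ≡ ∑ (λ j → x j ℚ.* Dmul G y j)
  ∑-Dmul-sym x y = begin
    ∑ (λ i → y i ℚ.* Dmul G x i)
      ≡⟨ ∑-cong (λ i → *-distribˡ-∑ (y i) (λ j → Dmat G i j ℚ.* x j)) ⟩
    ∑ (λ i → ∑ (λ j → y i ℚ.* (Dmat G i j ℚ.* x j)))
      ≡⟨ ∑-comm (λ i j → y i ℚ.* (Dmat G i j ℚ.* x j)) ⟩
    ∑ (λ j → ∑ (λ i → y i ℚ.* (Dmat G i j ℚ.* x j)))
      ≡⟨ ∑-cong (λ j → ∑-cong (λ i → exchange (y i) (x j) (D-sym i j))) ⟩
    ∑ (λ j → ∑ (λ i → x j ℚ.* (Dmat G j i ℚ.* y i)))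
      ≡⟨ ∑-cong (λ j → *-distribˡ-∑ (x j) (λ i → Dmat G j i ℚ.* y i)) ⟨
    ∑ (λ j → x j ℚ.* Dmul G y j)
      ∎
    where
    open +-*-Solver
    exchange : ∀ a b {d d′} → d ≡ d′ → a ℚ.* (d ℚ.* b) ≡ b ℚ.* (d′ ℚ.* a)
    exchange a b {d} refl = solve 3 (λ a b d → a :* (d :* b) := b :* (d :* a)) refl a b d

  constInX-unique : ∀ {a b} → ConstInX G a → ConstInX G b → b ≡ a
  constInX-unique {a} {b} (x , ∑x≡1 , Dx≡a) (y , ∑y≡1 , Dy≡b) = begin
    b                             ≡⟨ ℚP.*-identityˡ b ⟨
    1ℚ ℚ.* b                      ≡⟨ cong (ℚ._* b) ∑x≡1 ⟨
    ∑ x ℚ.* b                     ≡⟨ *-distribʳ-∑ b x ⟩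
    ∑ (λ j → x j ℚ.* b)           ≡⟨ ∑-cong (λ j → cong (x j ℚ.*_) (Dy≡b j)) ⟨
    ∑ (λ j → x j ℚ.* Dmul G y j)  ≡⟨ ∑-Dmul-sym x y ⟨
    ∑ (λ i → y i ℚ.* Dmul G x i)  ≡⟨ ∑-cong (λ i → cong (y i ℚ.*_) (Dx≡a i)) ⟩
    ∑ (λ i → y i ℚ.* a)           ≡⟨ *-distribʳ-∑ a y ⟨
    ∑ y ℚ.* a                     ≡⟨ cong (ℚ._* a) ∑y≡1 ⟩
    1ℚ ℚ.* a                      ≡⟨ ℚP.*-identityˡ a ⟩
    a                             ∎

nonzero-constInX⇒potential : ∀ {G a} → ConstInX G a → a ≢ 0ℚ →
                             Σ (Fin (size G) → ℚ) (λ x → IsCurvaturePotential G x × (∑ x ≢ 0ℚ))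
nonzero-constInX⇒potential {G} {a} (x , ∑x≡1 , Dx≡a) a≢0 = (λ j → x j ℚ.* a⁻¹) , potential , ∑≢0
  where
  open ≡-Reasoning
  instance
    a-nonZero : ℚ.NonZero a
    a-nonZero = ℚ.≢-nonZero a≢0
  a⁻¹ = ℚ.1/ a
  potential : IsCurvaturePotential G (λ j → x j ℚ.* a⁻¹)
  potential i = begin
    ∑ (λ j → Dmat G i j ℚ.* (x j ℚ.* a⁻¹))  ≡⟨ ∑-cong (λ j → ℚP.*-assoc (Dmat G i j) (x j) a⁻¹) ⟨
    ∑ (λ j → Dmat G i j ℚ.* x j ℚ.* a⁻¹)    ≡⟨ *-distribʳ-∑ a⁻¹ (λ j → Dmat G i j ℚ.* x j) ⟨
    Dmul G x i ℚ.* a⁻¹                      ≡⟨ cong (ℚ._* a⁻¹) (Dx≡a i) ⟩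
    a ℚ.* a⁻¹                               ≡⟨ ℚP.*-inverseʳ a ⟩
    1ℚ                                      ∎
  ∑≡a⁻¹ : ∑ (λ j → x j ℚ.* a⁻¹) ≡ a⁻¹
  ∑≡a⁻¹ = begin
    ∑ (λ j → x j ℚ.* a⁻¹)  ≡⟨ *-distribʳ-∑ a⁻¹ x ⟨
    ∑ x ℚ.* a⁻¹            ≡⟨ cong (ℚ._* a⁻¹) ∑x≡1 ⟩
    1ℚ ℚ.* a⁻¹             ≡⟨ ℚP.*-identityˡ a⁻¹ ⟩
    a⁻¹                    ∎
  ∑≢0 : ∑ (λ j → x j ℚ.* a⁻¹) ≢ 0ℚ
  ∑≢0 ∑≡0 = ℚP.1≢0 (begin
    1ℚ         ≡⟨ ℚP.*-inverseʳ a ⟨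
    a ℚ.* a⁻¹  ≡⟨ cong (a ℚ.*_) (trans (sym ∑≡a⁻¹) ∑≡0) ⟩
    a ℚ.* 0ℚ   ≡⟨ ℚP.*-zeroʳ a ⟩
    0ℚ         ∎)

one-vertex-distanceExceptional : (a : Fin 1 → Fin 1 → Bool) → DistanceExceptional (record { size = 1 ; adj = a })
one-vertex-distanceExceptional a (x , potential) = ℚP.1≢0 (begin
  1ℚ                     ≡⟨ potential zero ⟨
  0ℚ ℚ.* x zero ℚ.+ 0ℚ  ≡⟨ ℚP.+-identityʳ _ ⟩
  0ℚ ℚ.* x zero         ≡⟨ ℚP.*-zeroˡ (x zero) ⟩
  0ℚ                     ∎)
  where open ≡-Reasoning

curvatureIndexIs : ∀ {G a} → DistanceCertificate G → ConstInX G a → DistanceExceptional G ⊎ a ≢ 0ℚ →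
                   CurvatureIndexIs G a
curvatureIndexIs c X exceptional⊎a≢0 =
  map₂ (nonzero-constInX⇒potential X) exceptional⊎a≢0 , X , λ b Y → constInX-unique (Dmat-sym c) X Y

constInX-uniform : ∀ {G} k → size G ≡ suc k → ∀ R → (∀ u → ∑ (Dmat G u) ≡ fromℕ R) → ConstInX G (+ R / suc k)
constInX-uniform {G} k size≡1+k R rows = (λ _ → q) , ∑q≡1 , Dq≡R/1+k
  where
  open ≡-Reasoning
  q : ℚ
  q = + 1 / suc k
  ∑q≡1 : ∑ {size G} (λ _ → q) ≡ 1ℚ
  ∑q≡1 = begin
    ∑ {size G} (λ _ → q)     ≡⟨ ∑-const (size G) q ⟩
    fromℕ (size G) ℚ.* q     ≡⟨ cong (λ n → fromℕ n ℚ.* q) size≡1+k ⟩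
    fromℕ (suc k) ℚ.* q      ≡⟨ fromℕ-*-/ (suc k) 1 k ⟩
    + (suc k ℕ.* 1) / suc k  ≡⟨ /-≡-/ (suc k ℕ.* 1) k 1 0 (trans (ℕP.*-identityʳ (suc k ℕ.* 1)) (ℕP.*-comm (suc k) 1)) ⟩
    1ℚ                       ∎
  Dq≡R/1+k : ∀ u → Dmul G (λ _ → q) u ≡ + R / suc k
  Dq≡R/1+k u = begin
    ∑ (λ v → Dmat G u v ℚ.* q)  ≡⟨ *-distribʳ-∑ q (Dmat G u) ⟨
    ∑ (Dmat G u) ℚ.* q          ≡⟨ cong (ℚ._* q) (rows u) ⟩
    fromℕ R ℚ.* q               ≡⟨ fromℕ-*-/ R 1 k ⟩
    + (R ℕ.* 1) / suc k         ≡⟨ cong (λ a → + a / suc k) (ℕP.*-identityʳ R) ⟩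
    + R / suc k                 ∎

-- Cartesian products

module Coordinates (m n : ℕ) where
  open ≡-Reasoning

  π₁ : Fin (m ℕ.* n) → Fin m
  π₁ p = proj₁ (Fin.remQuot {m} n p)

  π₂ : Fin (m ℕ.* n) → Fin n
  π₂ p = proj₂ (Fin.remQuot {m} n p)

  π₁-combine : ∀ u v → π₁ (Fin.combine u v) ≡ u
  π₁-combine u v = cong proj₁ (remQuot-combine {m} {n} u v)

  π₂-combine : ∀ u v → π₂ (Fin.combine u v) ≡ v
  π₂-combine u v = cong proj₂ (remQuot-combine {m} {n} u v)

  π-injective : ∀ {p q} → π₁ p ≡ π₁ q → π₂ p ≡ π₂ q → p ≡ q
  π-injective {p} {q} π₁≡ π₂≡ =
    trans (sym (combine-remQuot {m} n p)) (trans (cong₂ Fin.combine π₁≡ π₂≡) (combine-remQuot {m} n q))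

  ∑-separable : ∀ (f : Fin m → ℚ) (g : Fin n → ℚ) → ∑ (λ p → f (π₁ p) ℚ.* g (π₂ p)) ≡ ∑ f ℚ.* ∑ g
  ∑-separable f g = begin
    ∑ (λ p → f (π₁ p) ℚ.* g (π₂ p))    ≡⟨ ∑-combine m n _ ⟩
    ∑ {m} (λ u → ∑ {n} (λ v → f (π₁ (Fin.combine u v)) ℚ.* g (π₂ (Fin.combine u v))))
      ≡⟨ ∑-cong (λ u → ∑-cong (λ v → cong₂ ℚ._*_ (cong f (π₁-combine u v)) (cong g (π₂-combine u v)))) ⟩
    ∑ (λ u → ∑ (λ v → f u ℚ.* g v))    ≡⟨ ∑-cong (λ u → *-distribˡ-∑ (f u) g) ⟨
    ∑ (λ u → f u ℚ.* ∑ g)              ≡⟨ *-distribʳ-∑ (∑ g) f ⟨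
    ∑ f ℚ.* ∑ g                        ∎

a<m⇒b<n⇒a+b<m*n : ∀ {a b m n} → a < m → b < n → a ℕ.+ b < m ℕ.* n
a<m⇒b<n⇒a+b<m*n {a} {b} {suc m} {suc n} (s≤s a≤m) (s≤s b≤n) = s≤s (ℕP.≤-trans (ℕP.+-mono-≤ a≤m b≤n)
  (subst (ℕ._≤ n ℕ.+ m ℕ.* suc n) (ℕP.+-comm n m) (ℕP.+-monoʳ-≤ n (ℕP.m≤m*n m (suc n)))))

module _ {G H : Graph} (cG : DistanceCertificate G) (cH : DistanceCertificate H) where
  private
    module CG = DistanceCertificate cG
    module CH = DistanceCertificate cH
  open Coordinates (size G) (size H)

  □-Adjacent : Fin (size G ℕ.* size H) → Fin (size G ℕ.* size H) → Set
  □-Adjacent p q = (π₁ p ≡ π₁ q × T (adj H (π₂ p) (π₂ q))) ⊎ (π₂ p ≡ π₂ q × T (adj G (π₁ p) (π₁ q)))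

  □-adj-cases : ∀ {p q} → T (adj (G □ H) p q) → □-Adjacent p q
  □-adj-cases {p} {q} e with to (T-∨ {finEq (π₁ p) (π₁ q) ∧ adj H (π₂ p) (π₂ q)}) e
  ... | inj₁ e′ = let (π₁≡ , eH) = to (T-∧ {finEq (π₁ p) (π₁ q)}) e′ in inj₁ (finEq⇒≡ π₁≡ , eH)
  ... | inj₂ e′ = let (π₂≡ , eG) = to (T-∧ {finEq (π₂ p) (π₂ q)}) e′ in inj₂ (finEq⇒≡ π₂≡ , eG)

  □-adj-intro : ∀ {p q} → □-Adjacent p q → T (adj (G □ H) p q)
  □-adj-intro {p} {q} (inj₁ (π₁≡ , eH)) = from (T-∨ {finEq (π₁ p) (π₁ q) ∧ adj H (π₂ p) (π₂ q)})
    (inj₁ (from (T-∧ {finEq (π₁ p) (π₁ q)}) (≡⇒finEq π₁≡ , eH)))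
  □-adj-intro {p} {q} (inj₂ (π₂≡ , eG)) = from (T-∨ {finEq (π₁ p) (π₁ q) ∧ adj H (π₂ p) (π₂ q)})
    (inj₂ (from (T-∧ {finEq (π₂ p) (π₂ q)}) (≡⇒finEq π₂≡ , eG)))

  δ□ : Fin (size G ℕ.* size H) → Fin (size G ℕ.* size H) → ℕ
  δ□ p q = CG.δ (π₁ p) (π₁ q) ℕ.+ CH.δ (π₂ p) (π₂ q)

  δ□-combine : ∀ u x y → δ□ u (Fin.combine x y) ≡ CG.δ (π₁ u) x ℕ.+ CH.δ (π₂ u) y
  δ□-combine u x y = cong₂ ℕ._+_ (cong (CG.δ (π₁ u)) (π₁-combine x y)) (cong (CH.δ (π₂ u)) (π₂-combine x y))

  δ□-edge : ∀ u {w v} → T (adj (G □ H) w v) → δ□ u v ≤ suc (δ□ u w)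
  δ□-edge u {w} {v} e with □-adj-cases e
  ... | inj₁ (π₁≡ , eH) = begin
    CG.δ (π₁ u) (π₁ v) ℕ.+ CH.δ (π₂ u) (π₂ v)        ≤⟨ ℕP.+-monoʳ-≤ _ (CH.δ-edge (π₂ u) eH) ⟩
    CG.δ (π₁ u) (π₁ v) ℕ.+ suc (CH.δ (π₂ u) (π₂ w))  ≡⟨ ℕP.+-suc _ _ ⟩
    suc (CG.δ (π₁ u) (π₁ v) ℕ.+ CH.δ (π₂ u) (π₂ w))  ≡⟨ cong (λ z → suc (CG.δ (π₁ u) z ℕ.+ _)) π₁≡ ⟨
    suc (δ□ u w)                                      ∎
    where open ℕP.≤-Reasoning
  ... | inj₂ (π₂≡ , eG) = begin
    CG.δ (π₁ u) (π₁ v) ℕ.+ CH.δ (π₂ u) (π₂ v)        ≤⟨ ℕP.+-monoˡ-≤ _ (CG.δ-edge (π₁ u) eG) ⟩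
    suc (CG.δ (π₁ u) (π₁ w) ℕ.+ CH.δ (π₂ u) (π₂ v))  ≡⟨ cong (λ z → suc (_ ℕ.+ CH.δ (π₂ u) z)) π₂≡ ⟨
    suc (δ□ u w)                                      ∎
    where open ℕP.≤-Reasoning

  δ□-descent : ∀ u v → δ□ u v ≢ 0 → ∃[ w ] T (adj (G □ H) w v) × δ□ u w < δ□ u v
  δ□-descent u v δ≢0 with CH.δ (π₂ u) (π₂ v) ℕP.≟ 0
  ... | no δH≢0 =
    let (y , e , closer) = CH.δ-descent (π₂ u) (π₂ v) δH≢0 in
    Fin.combine (π₁ v) y ,
    □-adj-intro (inj₁ (π₁-combine (π₁ v) y , subst (λ z → T (adj H z (π₂ v))) (sym (π₂-combine (π₁ v) y)) e)) ,
    subst (_< δ□ u v) (sym (δ□-combine u (π₁ v) y)) (ℕP.+-monoʳ-< (CG.δ (π₁ u) (π₁ v)) closer)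
  ... | yes δH≡0 =
    let (x , e , closer) = CG.δ-descent (π₁ u) (π₁ v) (λ δG≡0 → δ≢0 (cong₂ ℕ._+_ δG≡0 δH≡0)) in
    Fin.combine x (π₂ v) ,
    □-adj-intro (inj₂ (π₂-combine x (π₂ v) , subst (λ z → T (adj G z (π₁ v))) (sym (π₁-combine x (π₂ v))) e)) ,
    subst (_< δ□ u v) (sym (δ□-combine u x (π₂ v))) (ℕP.+-monoˡ-< (CH.δ (π₂ u) (π₂ v)) closer)

  □-certificate : DistanceCertificate (G □ H)
  □-certificate = record
    { δ         = δ□
    ; δ≡0⇒≡     = λ {p} {q} δ≡0 → π-injective (CG.δ≡0⇒≡ (ℕP.m+n≡0⇒m≡0 _ δ≡0))
                                                (CH.δ≡0⇒≡ (ℕP.m+n≡0⇒n≡0 (CG.δ (π₁ p) (π₁ q)) δ≡0))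
    ; δ-refl    = λ p → cong₂ ℕ._+_ (CG.δ-refl (π₁ p)) (CH.δ-refl (π₂ p))
    ; δ-sym     = λ p q → cong₂ ℕ._+_ (CG.δ-sym (π₁ p) (π₁ q)) (CH.δ-sym (π₂ p) (π₂ q))
    ; δ-edge    = δ□-edge
    ; δ-descent = δ□-descent
    ; δ<size    = λ p q → a<m⇒b<n⇒a+b<m*n (CG.δ<size (π₁ p) (π₁ q)) (CH.δ<size (π₂ p) (π₂ q))
    }

  Dmat-□ : ∀ p q → Dmat (G □ H) p q ≡ Dmat G (π₁ p) (π₁ q) ℚ.+ Dmat H (π₂ p) (π₂ q)
  Dmat-□ p q = trans (cong fromℕ (trans (dist≡δ □-certificate p q)
                                        (sym (cong₂ ℕ._+_ (dist≡δ cG (π₁ p) (π₁ q)) (dist≡δ cH (π₂ p) (π₂ q))))))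
                     (fromℕ-+ (dist G (π₁ p) (π₁ q)) (dist H (π₂ p) (π₂ q)))

  constInX-□ : ∀ {a b} → ConstInX G a → ConstInX H b → ConstInX (G □ H) (a ℚ.+ b)
  constInX-□ {a} {b} (x , ∑x≡1 , Dx≡a) (y , ∑y≡1 , Dy≡b) =
    z , trans (∑-separable x y) (cong₂ ℚ._*_ ∑x≡1 ∑y≡1) , Dz≡a+b
    where
    open ≡-Reasoning
    open +-*-Solver
    z : Fin (size G ℕ.* size H) → ℚ
    z p = x (π₁ p) ℚ.* y (π₂ p)
    Dz≡a+b : ∀ p → Dmul (G □ H) z p ≡ a ℚ.+ b
    Dz≡a+b p = begin
      ∑ (λ q → Dmat (G □ H) p q ℚ.* z q)
        ≡⟨ ∑-cong separate ⟩
      ∑ (λ q → f (π₁ q) ℚ.* y (π₂ q) ℚ.+ x (π₁ q) ℚ.* g (π₂ q))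
        ≡⟨ ∑-distrib-+ (λ q → f (π₁ q) ℚ.* y (π₂ q)) _ ⟩
      ∑ (λ q → f (π₁ q) ℚ.* y (π₂ q)) ℚ.+ ∑ (λ q → x (π₁ q) ℚ.* g (π₂ q))
        ≡⟨ cong₂ ℚ._+_ (∑-separable f y) (∑-separable x g) ⟩
      ∑ f ℚ.* ∑ y ℚ.+ ∑ x ℚ.* ∑ g
        ≡⟨ cong₂ ℚ._+_ (cong₂ ℚ._*_ (Dx≡a (π₁ p)) ∑y≡1) (cong₂ ℚ._*_ ∑x≡1 (Dy≡b (π₂ p))) ⟩
      a ℚ.* 1ℚ ℚ.+ 1ℚ ℚ.* b
        ≡⟨ cong₂ ℚ._+_ (ℚP.*-identityʳ a) (ℚP.*-identityˡ b) ⟩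
      a ℚ.+ b
        ∎
      where
      f : Fin (size G) → ℚ
      f u = Dmat G (π₁ p) u ℚ.* x u
      g : Fin (size H) → ℚ
      g v = Dmat H (π₂ p) v ℚ.* y v
      separate : ∀ q → Dmat (G □ H) p q ℚ.* z q ≡ f (π₁ q) ℚ.* y (π₂ q) ℚ.+ x (π₁ q) ℚ.* g (π₂ q)
      separate q = trans (cong (ℚ._* z q) (Dmat-□ p q))
        (solve 4 (λ d e s t → (d :+ e) :* (s :* t) := d :* s :* t :+ s :* (e :* t)) refl
           (Dmat G (π₁ p) (π₁ q)) (Dmat H (π₂ p) (π₂ q)) (x (π₁ q)) (y (π₂ q)))

-- Complete graphs and Cartesian powers

δK : ∀ {n} → Fin n → Fin n → ℕ
δK u v = if finEq u v then 0 else 1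

δK-≡ : ∀ {n} {u v : Fin n} → u ≡ v → δK u v ≡ 0
δK-≡ u≡v = cong (λ b → if b then 0 else 1) (to T-≡ (≡⇒finEq u≡v))

δK-≢ : ∀ {n} {u v : Fin n} → u ≢ v → δK u v ≡ 1
δK-≢ {u = u} {v} u≢v with finEq u v in eq
... | true  = ⊥-elim (u≢v (finEq⇒≡ (subst T (sym eq) _)))
... | false = refl

two-distinct⇒1< : ∀ {n} {u v : Fin n} → u ≢ v → 1 < n
two-distinct⇒1< {suc zero}    {zero} {zero} u≢v = ⊥-elim (u≢v refl)
two-distinct⇒1< {suc (suc n)} _                = s≤s (s≤s z≤n)

K-certificate : ∀ n → DistanceCertificate (K n)
K-certificate n = record
  { δ         = δK
  ; δ≡0⇒≡     = δ≡0⇒≡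
  ; δ-refl    = λ u → δK-≡ {u = u} refl
  ; δ-sym     = δ-sym
  ; δ-edge    = λ u {w} {v} _ → ℕP.≤-trans (δK≤1 u v) (s≤s z≤n)
  ; δ-descent = descent
  ; δ<size    = δ<size
  }
  where
  δ≡0⇒≡ : ∀ {u v : Fin n} → δK u v ≡ 0 → u ≡ v
  δ≡0⇒≡ {u} {v} δ≡0 with u Fin.≟ v
  ... | yes u≡v = u≡v
  ... | no  u≢v = ⊥-elim (ℕP.1+n≢0 (trans (sym (δK-≢ u≢v)) δ≡0))
  δ-sym : ∀ (u v : Fin n) → δK u v ≡ δK v u
  δ-sym u v with u Fin.≟ v
  ... | yes refl = refl
  ... | no  u≢v  = trans (δK-≢ u≢v) (sym (δK-≢ (u≢v ∘ sym)))
  δK≤1 : ∀ (u v : Fin n) → δK u v ≤ 1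
  δK≤1 u v with finEq u v
  ... | true  = z≤n
  ... | false = s≤s z≤n
  descent : ∀ (u v : Fin n) → δK u v ≢ 0 → ∃[ w ] T (not (finEq w v)) × δK u w < δK u v
  descent u v δ≢0 with finEq u v in eq
  ... | true  = ⊥-elim (δ≢0 refl)
  ... | false = u , from T-not-≡ eq , subst (_< 1) (sym (δK-≡ {u = u} refl)) (s≤s z≤n)
  δ<size : ∀ (u v : Fin n) → δK u v < n
  δ<size u v with u Fin.≟ v
  ... | yes u≡v = subst (_< n) (sym (δK-≡ u≡v)) (ℕP.≤-<-trans z≤n (toℕ<n u))
  ... | no  u≢v = subst (_< n) (sym (δK-≢ u≢v)) (two-distinct⇒1< u≢v)

K-rowSum : ∀ n (u : Fin (suc n)) → ∑ (λ v → fromℕ (δK u v)) ≡ fromℕ n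
K-rowSum n       zero    = trans (ℚP.+-identityˡ _) (trans (∑-const n 1ℚ) (ℚP.*-identityʳ (fromℕ n)))
K-rowSum (suc n) (suc u) = trans (cong (1ℚ ℚ.+_) (K-rowSum n u)) (sym (fromℕ-+ 1 n))

K-constInX : ∀ k → ConstInX (K (suc k)) (+ k / suc k)
K-constInX k = constInX-uniform k refl k λ u →
  trans (∑-cong (λ v → cong fromℕ (dist≡δ (K-certificate (suc k)) u v))) (K-rowSum k u)

^□-certificate : ∀ {G} → DistanceCertificate G → ∀ d → DistanceCertificate (G ^□ d)
^□-certificate c zero    = K-certificate 1
^□-certificate c (suc d) = □-certificate c (^□-certificate c d)

constInX-^□ : ∀ {G a} → DistanceCertificate G → ConstInX G a → ∀ d → ConstInX (G ^□ d) (fromℕ d ℚ.* a)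
constInX-^□ {G} {a} c X zero    = subst (ConstInX (K 1)) (sym (ℚP.*-zeroˡ a)) (K-constInX 0)
constInX-^□ {G} {a} c X (suc d) =
  subst (ConstInX (G ^□ suc d)) a+da≡[1+d]a (constInX-□ c (^□-certificate c d) X (constInX-^□ c X d))
  where
  a+da≡[1+d]a : a ℚ.+ fromℕ d ℚ.* a ≡ fromℕ (suc d) ℚ.* a
  a+da≡[1+d]a = begin
    a ℚ.+ fromℕ d ℚ.* a           ≡⟨ cong (ℚ._+ fromℕ d ℚ.* a) (ℚP.*-identityˡ a) ⟨
    1ℚ ℚ.* a ℚ.+ fromℕ d ℚ.* a    ≡⟨ ℚP.*-distribʳ-+ a 1ℚ (fromℕ d) ⟨
    (1ℚ ℚ.+ fromℕ d) ℚ.* a        ≡⟨ cong (ℚ._* a) (fromℕ-+ 1 d) ⟨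
    fromℕ (suc d) ℚ.* a           ∎
    where open ≡-Reasoning

-- Paths

∣n-1+n∣≡1 : ∀ n → ∣ n - suc n ∣ ≡ 1
∣n-1+n∣≡1 zero    = refl
∣n-1+n∣≡1 (suc n) = ∣n-1+n∣≡1 n

∣-∣-step : ∀ i {p q} → ∣ p - q ∣ ≡ 1 → ∣ i - q ∣ ≤ suc ∣ i - p ∣
∣-∣-step i {p} {q} ∣p-q∣≡1 = ℕP.≤-trans (ℕP.∣-∣-triangle i p q)
  (ℕP.≤-reflexive (trans (cong (∣ i - p ∣ ℕ.+_) ∣p-q∣≡1) (ℕP.+-comm ∣ i - p ∣ 1)))

∣m-1+n∣≡1+∣m-n∣ : ∀ {m n} → m ≤ n → ∣ m - suc n ∣ ≡ suc ∣ m - n ∣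
∣m-1+n∣≡1+∣m-n∣ {zero}  {n}     _         = refl
∣m-1+n∣≡1+∣m-n∣ {suc m} {suc n} (s≤s m≤n) = ∣m-1+n∣≡1+∣m-n∣ m≤n

∣m-n∣≡1+∣m-1+n∣ : ∀ {m n} → n < m → ∣ m - n ∣ ≡ suc ∣ m - suc n ∣
∣m-n∣≡1+∣m-1+n∣ {suc m} {zero}  _         = cong suc (sym (ℕP.∣-∣-identityʳ m))
∣m-n∣≡1+∣m-1+n∣ {suc m} {suc n} (s≤s n<m) = ∣m-n∣≡1+∣m-1+n∣ n<m

∣m-0∣+∣m-n∣≡n : ∀ {m n} → m ≤ n → ∣ m - 0 ∣ ℕ.+ ∣ m - n ∣ ≡ n
∣m-0∣+∣m-n∣≡n {m} {n} m≤n =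
  trans (cong₂ ℕ._+_ (ℕP.∣-∣-identityʳ m) (ℕP.m≤n⇒∣m-n∣≡n∸m m≤n)) (ℕP.m+[n∸m]≡n m≤n)

∣-∣<n : ∀ {i j n} → i < n → j < n → ∣ i - j ∣ < n
∣-∣<n {i} {j} i<n j<n = ℕP.≤-<-trans (ℕP.∣m-n∣≤m⊔n i j) (ℕP.⊔-lub i<n j<n)

witness-fromℕ< : ∀ {n} (Q : ℕ → Set) {p} → p < n → Q p → ∃[ w ] Q (toℕ {n} w)
witness-fromℕ< Q p<n Qp = Fin.fromℕ< p<n , subst Q (sym (toℕ-fromℕ< p<n)) Qp

P-adj⇒∣-∣≡1 : ∀ p q → T ((suc p ≡ᵇ q) ∨ (suc q ≡ᵇ p)) → ∣ p - q ∣ ≡ 1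
P-adj⇒∣-∣≡1 p q e with to (T-∨ {suc p ≡ᵇ q}) e
... | inj₁ e′ with ℕP.≡ᵇ⇒≡ (suc p) q e′
...   | refl = ∣n-1+n∣≡1 p
P-adj⇒∣-∣≡1 p q e | inj₂ e′ with ℕP.≡ᵇ⇒≡ (suc q) p e′
...   | refl = trans (ℕP.∣-∣-comm (suc q) q) (∣n-1+n∣≡1 q)

P-certificate : ∀ n → DistanceCertificate (P n)
P-certificate n = record
  { δ         = δ
  ; δ≡0⇒≡     = λ δ≡0 → toℕ-injective (ℕP.∣m-n∣≡0⇒m≡n δ≡0)
  ; δ-refl    = λ u → ℕP.∣n-n∣≡0 (toℕ u)
  ; δ-sym     = λ u v → ℕP.∣-∣-comm (toℕ u) (toℕ v)
  ; δ-edge    = λ u {w} {v} e → ∣-∣-step (toℕ u) (P-adj⇒∣-∣≡1 (toℕ w) (toℕ v) e)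
  ; δ-descent = descent
  ; δ<size    = λ u v → ∣-∣<n (toℕ<n u) (toℕ<n v)
  }
  where
  δ : Fin n → Fin n → ℕ
  δ u v = ∣ toℕ u - toℕ v ∣
  descent : ∀ u v → δ u v ≢ 0 → ∃[ w ] T (adj (P n) w v) × δ u w < δ u v
  descent u v δ≢0 with toℕ u | toℕ v | toℕ<n u | toℕ<n v | ℕP.<-cmp (toℕ u) (toℕ v)
  ... | i | q       | _   | _   | tri≈ _ i≡q _ = ⊥-elim (δ≢0 (trans (cong (∣ i -_∣) (sym i≡q)) (ℕP.∣n-n∣≡0 i)))
  ... | i | suc p   | _   | q<n | tri< i<q _ _ =
        witness-fromℕ< (λ w → T ((suc w ≡ᵇ suc p) ∨ (suc (suc p) ≡ᵇ w)) × ∣ i - w ∣ < ∣ i - suc p ∣)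
          (ℕP.<-trans (ℕP.n<1+n p) q<n) (from (T-∨ {suc p ≡ᵇ suc p}) (inj₁ (ℕP.≡⇒≡ᵇ p p refl)) ,
           ℕP.≤-reflexive (sym (∣m-1+n∣≡1+∣m-n∣ (ℕP.≤-pred i<q))))
  ... | i | q       | i<n | _   | tri> _ _ q<i =
        witness-fromℕ< (λ w → T ((suc w ≡ᵇ q) ∨ (suc q ≡ᵇ w)) × ∣ i - w ∣ < ∣ i - q ∣)
          (ℕP.≤-<-trans q<i i<n) (from (T-∨ {suc (suc q) ≡ᵇ q}) (inj₂ (ℕP.≡⇒≡ᵇ q q refl)) ,
           ℕP.≤-reflexive (sym (∣m-n∣≡1+∣m-1+n∣ q<i)))

P-constInX : ∀ k → ConstInX (P (suc k)) (+ k / 2)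
P-constInX k = x , ∑x≡1 , Dx≡k/2
  where
  open ≡-Reasoning
  ½ : ℚ
  ½ = + 1 / 2
  end : Fin (suc k)
  end = Fin.fromℕ k
  at : Fin (suc k) → Fin (suc k) → ℚ
  at w j = if finEq j w then ½ else 0ℚ
  x : Fin (suc k) → ℚ
  x j = at zero j ℚ.+ at end j
  ∑x≡1 : ∑ x ≡ 1ℚ
  ∑x≡1 = trans (∑-distrib-+ (at zero) (at end))
               (cong₂ ℚ._+_ (∑-indicator {suc k} zero (λ _ → ½)) (∑-indicator end (λ _ → ½)))
  Dx≡k/2 : ∀ i → Dmul (P (suc k)) x i ≡ + k / 2
  Dx≡k/2 i = begin
    ∑ (λ j → D i j ℚ.* (at zero j ℚ.+ at end j))
      ≡⟨ ∑-cong (λ j → ℚP.*-distribˡ-+ (D i j) (at zero j) (at end j)) ⟩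
    ∑ (λ j → D i j ℚ.* at zero j ℚ.+ D i j ℚ.* at end j)
      ≡⟨ ∑-distrib-+ (λ j → D i j ℚ.* at zero j) (λ j → D i j ℚ.* at end j) ⟩
    ∑ (λ j → D i j ℚ.* at zero j) ℚ.+ ∑ (λ j → D i j ℚ.* at end j)
      ≡⟨ cong₂ ℚ._+_ (∑-D-at zero) (∑-D-at end) ⟩
    D i zero ℚ.* ½ ℚ.+ D i end ℚ.* ½
      ≡⟨ ℚP.*-distribʳ-+ ½ (D i zero) (D i end) ⟨
    (D i zero ℚ.+ D i end) ℚ.* ½
      ≡⟨ cong (ℚ._* ½) (trans (sym (fromℕ-+ (dist (P (suc k)) i zero) _)) (cong fromℕ ends)) ⟩
    fromℕ k ℚ.* ½
      ≡⟨ fromℕ-*-/ k 1 1 ⟩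
    + (k ℕ.* 1) / 2
      ≡⟨ cong (λ a → + a / 2) (ℕP.*-identityʳ k) ⟩
    + k / 2
      ∎
    where
    D = Dmat (P (suc k))
    ∑-D-at : ∀ w → ∑ (λ j → D i j ℚ.* at w j) ≡ D i w ℚ.* ½
    ∑-D-at w = trans (∑-cong (λ j → *-if (D i j) (finEq j w) ½)) (∑-indicator w (λ j → D i j ℚ.* ½))
    ends : dist (P (suc k)) i zero ℕ.+ dist (P (suc k)) i end ≡ k
    ends = begin
      dist (P (suc k)) i zero ℕ.+ dist (P (suc k)) i end
        ≡⟨ cong₂ ℕ._+_ (dist≡δ (P-certificate (suc k)) i zero) (dist≡δ (P-certificate (suc k)) i end) ⟩
      ∣ toℕ i - 0 ∣ ℕ.+ ∣ toℕ i - toℕ end ∣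
        ≡⟨ cong (λ e → ∣ toℕ i - 0 ∣ ℕ.+ ∣ toℕ i - e ∣) (toℕ-fromℕ k) ⟩
      ∣ toℕ i - 0 ∣ ℕ.+ ∣ toℕ i - k ∣
        ≡⟨ ∣m-0∣+∣m-n∣≡n (ℕP.≤-pred (toℕ<n i)) ⟩
      k ∎

-- Cycles

sumBelow : ℕ → (ℕ → ℕ) → ℕ
sumBelow zero    g = 0
sumBelow (suc n) g = g 0 ℕ.+ sumBelow n (g ∘ suc)

sumBelow-cong : ∀ n {f g : ℕ → ℕ} → (∀ {t} → t < n → f t ≡ g t) → sumBelow n f ≡ sumBelow n g
sumBelow-cong zero    _   = refl
sumBelow-cong (suc n) f≗g = cong₂ ℕ._+_ (f≗g (s≤s z≤n)) (sumBelow-cong n (f≗g ∘ s≤s))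

sumBelow-snoc : ∀ n g → sumBelow (suc n) g ≡ sumBelow n g ℕ.+ g n
sumBelow-snoc zero    g = ℕP.+-comm (g 0) 0
sumBelow-snoc (suc n) g =
  trans (cong (g 0 ℕ.+_) (sumBelow-snoc n (g ∘ suc))) (sym (ℕP.+-assoc (g 0) (sumBelow n (g ∘ suc)) (g (suc n))))

sumBelow-suc : ∀ n g → sumBelow n (suc ∘ g) ≡ n ℕ.+ sumBelow n g
sumBelow-suc zero    g = refl
sumBelow-suc (suc n) g = trans (cong (suc (g 0) ℕ.+_) (sumBelow-suc n (g ∘ suc)))
  (solve 3 (λ a n s → con 1 :+ a :+ (n :+ s) := con 1 :+ n :+ (a :+ s)) refl (g 0) n (sumBelow n (g ∘ suc)))
  where open ℕ-Solver

∑-fromℕ : ∀ n g → ∑ {n} (λ v → fromℕ (g (toℕ v))) ≡ fromℕ (sumBelow n g)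
∑-fromℕ zero    g = refl
∑-fromℕ (suc n) g = trans (cong (fromℕ (g 0) ℚ.+_) (∑-fromℕ n (g ∘ suc))) (sym (fromℕ-+ (g 0) (sumBelow n (g ∘ suc))))

-- The distance in C_N between two vertices whose labels differ by t ≤ N.
cycleDist : ℕ → ℕ → ℕ
cycleDist N t = t ⊓ (N ∸ t)

cycleDist-sym : ∀ N {t} → t ≤ N → cycleDist N (N ∸ t) ≡ cycleDist N t
cycleDist-sym N {t} t≤N = trans (cong ((N ∸ t) ⊓_) (ℕP.m∸[m∸n]≡n t≤N)) (ℕP.⊓-comm (N ∸ t) t)

cycleDist-step : ∀ N {s t} → s ≤ N → t ≤ suc s → s ≤ suc t → cycleDist N t ≤ suc (cycleDist N s)
cycleDist-step N {s} {t} s≤N t≤1+s s≤1+t =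
  ℕP.⊓-mono-≤ t≤1+s (ℕP.≤-trans (ℕP.∸-monoʳ-≤ (suc N) s≤1+t) (ℕP.≤-reflexive (ℕP.+-∸-assoc 1 s≤N)))

cycleDist-adjacent : ∀ N {s t} → s ≤ N → t ≤ N → t ≤ suc s → s ≤ suc t →
                     cycleDist N t ≤ suc (cycleDist N s) × cycleDist N s ≤ suc (cycleDist N t)
cycleDist-adjacent N s≤N t≤N t≤1+s s≤1+t = cycleDist-step N s≤N t≤1+s s≤1+t , cycleDist-step N t≤N s≤1+t t≤1+s

cycleDist≡0⇒≡0 : ∀ N {t} → t < N → cycleDist N t ≡ 0 → t ≡ 0
cycleDist≡0⇒≡0 N {t} t<N cd≡0 with ℕP.⊓-sel t (N ∸ t)
... | inj₁ cd≡t   = trans (sym cd≡t) cd≡0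
... | inj₂ cd≡N∸t = ⊥-elim (ℕP.<⇒≱ t<N (ℕP.m∸n≡0⇒m≤n (trans (sym cd≡N∸t) cd≡0)))

cycleDistSum : ℕ → ℕ
cycleDistSum N = sumBelow N (cycleDist N)

cycleDistSum-2+ : ∀ N → cycleDistSum (suc (suc N)) ≡ suc N ℕ.+ cycleDistSum N
cycleDistSum-2+ N = begin
  sumBelow (suc N) (λ t → cycleDist (suc (suc N)) (suc t))  ≡⟨ sumBelow-cong (suc N) shift ⟩
  sumBelow (suc N) (suc ∘ cycleDist N)                      ≡⟨ sumBelow-suc (suc N) (cycleDist N) ⟩
  suc N ℕ.+ sumBelow (suc N) (cycleDist N)                  ≡⟨ cong (suc N ℕ.+_) (sumBelow-snoc N (cycleDist N)) ⟩
  suc N ℕ.+ (cycleDistSum N ℕ.+ N ⊓ (N ∸ N))                ≡⟨ cong (λ c → suc N ℕ.+ (cycleDistSum N ℕ.+ N ⊓ c)) (ℕP.n∸n≡0 N) ⟩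
  suc N ℕ.+ (cycleDistSum N ℕ.+ N ⊓ 0)                      ≡⟨ cong (λ c → suc N ℕ.+ (cycleDistSum N ℕ.+ c)) (ℕP.⊓-zeroʳ N) ⟩
  suc N ℕ.+ (cycleDistSum N ℕ.+ 0)                          ≡⟨ cong (suc N ℕ.+_) (ℕP.+-identityʳ _) ⟩
  suc N ℕ.+ cycleDistSum N                                  ∎
  where
  open ≡-Reasoning
  shift : ∀ {t} → t < suc N → cycleDist (suc (suc N)) (suc t) ≡ suc (cycleDist N t)
  shift {t} t<1+N = cong (suc t ⊓_) (ℕP.+-∸-assoc 1 (ℕP.≤-pred t<1+N))

cycleDistSum-even : ∀ m → cycleDistSum (m ℕ.* 2) ≡ m ℕ.* m
cycleDistSum-even zero    = refl
cycleDistSum-even (suc m) = trans (cycleDistSum-2+ (m ℕ.* 2)) (trans (cong (suc (m ℕ.* 2) ℕ.+_) (cycleDistSum-even m))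
  (solve 1 (λ m → con 1 :+ m :* con 2 :+ m :* m := (con 1 :+ m) :* (con 1 :+ m)) refl m))
  where open ℕ-Solver

cycleDistSum-odd : ∀ m → cycleDistSum (suc (m ℕ.* 2)) ≡ m ℕ.* m ℕ.+ m
cycleDistSum-odd zero    = refl
cycleDistSum-odd (suc m) = trans (cycleDistSum-2+ (suc (m ℕ.* 2))) (trans (cong (suc (suc (m ℕ.* 2)) ℕ.+_) (cycleDistSum-odd m))
  (solve 1 (λ m → con 2 :+ m :* con 2 :+ (m :* m :+ m) := (con 1 :+ m) :* (con 1 :+ m) :+ (con 1 :+ m)) refl m))
  where open ℕ-Solver

module Cycle (k : ℕ) where

  N : ℕ
  N = suc k

  cd : ℕ → ℕ
  cd = cycleDist N

  cd∣i-k∣≡cd[1+i] : ∀ {i} → i < N → cd ∣ i - k ∣ ≡ cd (suc i)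
  cd∣i-k∣≡cd[1+i] i<N = trans (cong cd (ℕP.m≤n⇒∣m-n∣≡n∸m (ℕP.≤-pred i<N))) (cycleDist-sym N i<N)

  cd-edge : ∀ {i p} → i < N → p < N →
            cd ∣ i - suc p % N ∣ ≤ suc (cd ∣ i - p ∣) × cd ∣ i - p ∣ ≤ suc (cd ∣ i - suc p % N ∣)
  cd-edge {i} {p} i<N p<N with ℕP.m≤n⇒m<n∨m≡n (ℕP.≤-pred p<N)
  ... | inj₁ p<k rewrite DM.m<n⇒m%n≡m (s≤s p<k) =
    cycleDist-adjacent N (ℕP.<⇒≤ (∣-∣<n i<N p<N)) (ℕP.<⇒≤ (∣-∣<n i<N (s≤s p<k)))
      (∣-∣-step i (∣n-1+n∣≡1 p)) (∣-∣-step i (trans (ℕP.∣-∣-comm (suc p) p) (∣n-1+n∣≡1 p)))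
  ... | inj₂ refl = subst₂ (λ a b → a ≤ suc b × b ≤ suc a) (sym cd∣i-0∣≡cd[i]) (sym (cd∣i-k∣≡cd[1+i] i<N))
    (cycleDist-adjacent N i<N (ℕP.<⇒≤ i<N) (ℕP.m≤n⇒m≤1+n (ℕP.n≤1+n i)) ℕP.≤-refl)
    where
    cd∣i-0∣≡cd[i] : cd ∣ i - suc k % N ∣ ≡ cd i
    cd∣i-0∣≡cd[i] = trans (cong (λ q → cd ∣ i - q ∣) (DM.n%n≡0 N)) (cong cd (ℕP.∣-∣-identityʳ i))

  private
    toward : ∀ {D D′} → D ≤ N ∸ D → D′ < D → cd D′ < cd D
    toward {D} {D′} short D′<D =
      ℕP.≤-<-trans (ℕP.m⊓n≤m D′ (N ∸ D′)) (subst (D′ <_) (sym (ℕP.m≤n⇒m⊓n≡m short)) D′<D)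

    wrap : ∀ {D D′} → ¬ D ≤ N ∸ D → D′ ℕ.+ D ≡ k → cd D′ < cd D
    wrap {D} {D′} long D′+D≡k = ℕP.≤-<-trans (ℕP.m⊓n≤m D′ (N ∸ D′))
      (subst (D′ <_) (sym (ℕP.m≥n⇒m⊓n≡n (ℕP.<⇒≤ (ℕP.≰⇒> long))))
             (ℕP.m+n≤o⇒m≤o∸n (suc D′) (s≤s (ℕP.≤-reflexive D′+D≡k))))

    away : ∀ {D} → ¬ D ≤ N ∸ D → suc D ≤ N → cd (suc D) < cd D
    away {D} long 1+D≤N = ℕP.≤-<-trans (ℕP.m⊓n≤n (suc D) (N ∸ suc D))
      (subst (N ∸ suc D <_) (sym (ℕP.m≥n⇒m⊓n≡n (ℕP.<⇒≤ (ℕP.≰⇒> long)))) (ℕP.∸-monoʳ-< (ℕP.n<1+n D) 1+D≤N))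

  -- Step towards i along the shorter arc, or away from i along the longer one (possibly across 0 ~ k).
  cd-descent : ∀ {i q} → i < N → q < N → i ≢ q →
               ∃[ p ] p < N × (suc p % N ≡ q ⊎ suc q % N ≡ p) × cd ∣ i - p ∣ < cd ∣ i - q ∣
  cd-descent {i} {q} i<N q<N i≢q with ∣ i - q ∣ ℕ.≤? N ∸ ∣ i - q ∣ | ℕP.<-cmp i q
  ... | _ | tri≈ _ i≡q _ = ⊥-elim (i≢q i≡q)
  cd-descent {i} {suc p} i<N q<N _ | yes short | tri< i<q _ _ =
    p , ℕP.<-trans (ℕP.n<1+n p) q<N , inj₁ (DM.m<n⇒m%n≡m q<N) ,
    toward short (ℕP.≤-reflexive (sym (∣m-1+n∣≡1+∣m-n∣ (ℕP.≤-pred i<q))))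
  cd-descent {i} {q} i<N q<N _ | yes short | tri> _ _ q<i =
    suc q , ℕP.≤-<-trans q<i i<N , inj₂ (DM.m<n⇒m%n≡m (ℕP.≤-<-trans q<i i<N)) ,
    toward short (ℕP.≤-reflexive (sym (∣m-n∣≡1+∣m-1+n∣ q<i)))
  cd-descent {i} {q} i<N q<N _ | no long | tri< i<q _ _ with ℕP.m≤n⇒m<n∨m≡n (ℕP.≤-pred q<N)
  ... | inj₁ q<k =
    suc q , s≤s q<k , inj₂ (DM.m<n⇒m%n≡m (s≤s q<k)) ,
    subst (λ D → cd D < cd ∣ i - q ∣) (sym ∣i-1+q∣≡1+∣i-q∣)
      (away long (subst (_≤ N) ∣i-1+q∣≡1+∣i-q∣ (ℕP.<⇒≤ (∣-∣<n i<N (s≤s q<k)))))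
    where
    ∣i-1+q∣≡1+∣i-q∣ : ∣ i - suc q ∣ ≡ suc ∣ i - q ∣
    ∣i-1+q∣≡1+∣i-q∣ = ∣m-1+n∣≡1+∣m-n∣ (ℕP.<⇒≤ i<q)
  ... | inj₂ refl =
    0 , s≤s z≤n , inj₂ (DM.n%n≡0 N) , wrap long (∣m-0∣+∣m-n∣≡n (ℕP.≤-pred i<N))
  cd-descent {i} {suc p} i<N q<N _ | no long | tri> _ _ q<i =
    p , ℕP.<-trans (ℕP.n<1+n p) q<N , inj₁ (DM.m<n⇒m%n≡m q<N) ,
    subst (λ D → cd D < cd ∣ i - suc p ∣) (sym ∣i-p∣≡1+∣i-1+p∣)
      (away long (subst (_≤ N) ∣i-p∣≡1+∣i-1+p∣ (ℕP.<⇒≤ (∣-∣<n i<N (ℕP.<-trans (ℕP.n<1+n p) q<N)))))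
    where
    ∣i-p∣≡1+∣i-1+p∣ : ∣ i - p ∣ ≡ suc ∣ i - suc p ∣
    ∣i-p∣≡1+∣i-1+p∣ = ∣m-n∣≡1+∣m-1+n∣ (ℕP.<-trans (ℕP.n<1+n p) q<i)
  cd-descent {i} {zero} i<N q<N _ | no long | tri> _ _ q<i =
    k , ℕP.n<1+n k , inj₁ (DM.n%n≡0 N) ,
    wrap long (trans (ℕP.+-comm ∣ i - k ∣ ∣ i - 0 ∣) (∣m-0∣+∣m-n∣≡n (ℕP.≤-pred i<N)))

  C-certificate : DistanceCertificate (C N)
  C-certificate = record
    { δ         = δ
    ; δ≡0⇒≡     = λ {u} {v} δ≡0 →
                    toℕ-injective (ℕP.∣m-n∣≡0⇒m≡n (cycleDist≡0⇒≡0 N (∣-∣<n (toℕ<n u) (toℕ<n v)) δ≡0))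
    ; δ-refl    = λ u → cong cd (ℕP.∣n-n∣≡0 (toℕ u))
    ; δ-sym     = λ u v → cong cd (ℕP.∣-∣-comm (toℕ u) (toℕ v))
    ; δ-edge    = edge
    ; δ-descent = descent
    ; δ<size    = λ u v → ℕP.≤-<-trans (ℕP.m⊓n≤m _ _) (∣-∣<n (toℕ<n u) (toℕ<n v))
    }
    where
    δ : Fin N → Fin N → ℕ
    δ u v = cd ∣ toℕ u - toℕ v ∣

    edge : ∀ u {w v} → T (adj (C N) w v) → δ u v ≤ suc (δ u w)
    edge u {w} {v} e with to (T-∨ {suc (toℕ w) % N ≡ᵇ toℕ v}) (proj₂ (to (T-∧ {not (finEq w v)}) e))
    ... | inj₁ e′ = subst (λ q → cd ∣ toℕ u - q ∣ ≤ suc (δ u w)) (ℕP.≡ᵇ⇒≡ _ _ e′)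
                          (proj₁ (cd-edge (toℕ<n u) (toℕ<n w)))
    ... | inj₂ e′ = subst (λ p → δ u v ≤ suc (cd ∣ toℕ u - p ∣)) (ℕP.≡ᵇ⇒≡ _ _ e′)
                          (proj₂ (cd-edge (toℕ<n u) (toℕ<n v)))

    descent : ∀ u v → δ u v ≢ 0 → ∃[ w ] T (adj (C N) w v) × δ u w < δ u v
    descent u v δ≢0 =
      let (p , p<N , neighbour , closer) = cd-descent (toℕ<n u) (toℕ<n v) i≢q in
      witness-fromℕ< (λ p → T (not (p ≡ᵇ toℕ v) ∧ ((suc p % N ≡ᵇ toℕ v) ∨ (suc (toℕ v) % N ≡ᵇ p)))
                            × cd ∣ toℕ u - p ∣ < δ u v)
        p<N (from (T-∧ {not (p ≡ᵇ toℕ v)}) (≢⇒T-not-≡ᵇ {p} {toℕ v} (p≢q closer) , adjacent neighbour) , closer)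
      where
      i≢q : toℕ u ≢ toℕ v
      i≢q i≡q = δ≢0 (trans (cong (λ q → cd ∣ toℕ u - q ∣) (sym i≡q)) (cong cd (ℕP.∣n-n∣≡0 (toℕ u))))
      p≢q : ∀ {p} → cd ∣ toℕ u - p ∣ < δ u v → p ≢ toℕ v
      p≢q closer p≡q = ℕP.<-irrefl (cong (λ q → cd ∣ toℕ u - q ∣) p≡q) closer
      adjacent : ∀ {p} → suc p % N ≡ toℕ v ⊎ suc (toℕ v) % N ≡ p →
                 T ((suc p % N ≡ᵇ toℕ v) ∨ (suc (toℕ v) % N ≡ᵇ p))
      adjacent {p} (inj₁ eq) = from (T-∨ {suc p % N ≡ᵇ toℕ v}) (inj₁ (ℕP.≡⇒≡ᵇ _ _ eq))
      adjacent {p} (inj₂ eq) = from (T-∨ {suc p % N ≡ᵇ toℕ v}) (inj₂ (ℕP.≡⇒≡ᵇ _ _ eq))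

  rowSum : ℕ → ℕ
  rowSum i = sumBelow N (λ j → cd ∣ i - j ∣)

  -- rowSum (1 + i) unfolds to cd (1 + i) plus the first k terms of rowSum i.
  rowSum-suc : ∀ {i} → suc i < N → rowSum (suc i) ≡ rowSum i
  rowSum-suc {i} 1+i<N = begin
    cd (suc i) ℕ.+ sumBelow k (λ j → cd ∣ i - j ∣)     ≡⟨ ℕP.+-comm (cd (suc i)) _ ⟩
    sumBelow k (λ j → cd ∣ i - j ∣) ℕ.+ cd (suc i)     ≡⟨ cong (sumBelow k (λ j → cd ∣ i - j ∣) ℕ.+_) (cd∣i-k∣≡cd[1+i] i<N) ⟨
    sumBelow k (λ j → cd ∣ i - j ∣) ℕ.+ cd ∣ i - k ∣   ≡⟨ sumBelow-snoc k (λ j → cd ∣ i - j ∣) ⟨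
    rowSum i                                          ∎
    where
    open ≡-Reasoning
    i<N : i < N
    i<N = ℕP.<-trans (ℕP.n<1+n i) 1+i<N

  rowSum≡cycleDistSum : ∀ {i} → i < N → rowSum i ≡ cycleDistSum N
  rowSum≡cycleDistSum {zero}  _     = refl
  rowSum≡cycleDistSum {suc i} 1+i<N = trans (rowSum-suc 1+i<N) (rowSum≡cycleDistSum (ℕP.<-trans (ℕP.n<1+n i) 1+i<N))

  C-constInX : ConstInX (C N) (+ cycleDistSum N / N)
  C-constInX = constInX-uniform k refl (cycleDistSum N) λ u → begin
    ∑ (Dmat (C N) u)                        ≡⟨ ∑-cong (λ v → cong fromℕ (dist≡δ C-certificate u v)) ⟩
    ∑ {N} (λ v → fromℕ (cd ∣ toℕ u - toℕ v ∣)) ≡⟨ ∑-fromℕ N (λ j → cd ∣ toℕ u - j ∣) ⟩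
    fromℕ (rowSum (toℕ u))                  ≡⟨ cong fromℕ (rowSum≡cycleDistSum (toℕ<n u)) ⟩
    fromℕ (cycleDistSum N)                  ∎
    where open ≡-Reasoning

¬2∣⇒odd : ∀ n → ¬ 2 ∣ n → ∃[ m ] n ≡ suc (m * 2)
¬2∣⇒odd n 2∤n with n % 2 in n%2≡r | DM.m%n<n n 2
... | 0           | _               = ⊥-elim (2∤n (m%n≡0⇒n∣m n 2 n%2≡r))
... | 1           | _               = n ℕ./ 2 , trans (DM.m≡m%n+[m/n]*n n 2) (cong (ℕ._+ n ℕ./ 2 * 2) n%2≡r)
... | suc (suc _) | s≤s (s≤s ())

scaledCycleIndex-even : ∀ d k m → suc k ≡ m * 2 →
                        fromℕ d ℚ.* (+ cycleDistSum (suc k) / suc k) ≡ (d * suc k) // 4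
scaledCycleIndex-even d k m 1+k≡2m = trans (fromℕ-*-/ d (cycleDistSum (suc k)) k)
  (/-≡-/ (d * cycleDistSum (suc k)) k (d * suc k) 3 (begin
  d * cycleDistSum (suc k) * 4  ≡⟨ cong (λ n → d * cycleDistSum n * 4) 1+k≡2m ⟩
  d * cycleDistSum (m * 2) * 4  ≡⟨ cong (λ s → d * s * 4) (cycleDistSum-even m) ⟩
  d * (m * m) * 4               ≡⟨ solve 2 (λ d m → d :* (m :* m) :* con 4 := d :* (m :* con 2) :* (m :* con 2)) refl d m ⟩
  d * (m * 2) * (m * 2)         ≡⟨ cong (λ n → d * n * n) 1+k≡2m ⟨
  d * suc k * suc k             ∎))
  where
  open ≡-Reasoning
  open ℕ-Solver

scaledCycleIndex-odd : ∀ d m → let n = suc (m * 2) in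
                       fromℕ d ℚ.* (+ cycleDistSum n / n) ≡ (d * (n * n ∸ 1)) // (4 * n)
scaledCycleIndex-odd d m = trans (fromℕ-*-/ d (cycleDistSum (suc (m * 2))) (m * 2))
  (/-≡-/ (d * cycleDistSum (suc (m * 2))) (m * 2)
         (d * (m * 2 ℕ.+ m * 2 * suc (m * 2))) (m * 2 ℕ.+ 3 * suc (m * 2)) (begin
  d * cycleDistSum (suc (m * 2)) * suc (m * 2 ℕ.+ 3 * suc (m * 2))
    ≡⟨ cong (λ s → d * s * suc (m * 2 ℕ.+ 3 * suc (m * 2))) (cycleDistSum-odd m) ⟩
  d * (m * m ℕ.+ m) * suc (m * 2 ℕ.+ 3 * suc (m * 2))
    ≡⟨ solve 2 (λ d m → d :* (m :* m :+ m) :* (con 1 :+ (m :* con 2 :+ con 3 :* (con 1 :+ m :* con 2)))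
                      := d :* (m :* con 2 :+ m :* con 2 :* (con 1 :+ m :* con 2)) :* (con 1 :+ m :* con 2)) refl d m ⟩
  d * (m * 2 ℕ.+ m * 2 * suc (m * 2)) * suc (m * 2) ∎))
  where
  open ≡-Reasoning
  open ℕ-Solver

C-curvatureIndex-even : ∀ n → 1 ≤ n → 2 ∣ n → CurvatureIndexIs (C n) (n // 4)
C-curvatureIndex-even (suc k) _ (divides m 1+k≡2m) =
  curvatureIndexIs C-certificate (subst (ConstInX (C (suc k))) value C-constInX) (inj₂ (//≢0 (suc k) 4))
  where
  open Cycle k
  value : + cycleDistSum (suc k) / suc k ≡ suc k // 4
  value = trans (sym (ℚP.*-identityˡ _))
                (trans (scaledCycleIndex-even 1 k m 1+k≡2m) (cong (_// 4) (ℕP.*-identityˡ (suc k))))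

C-curvatureIndex-1+2m : ∀ m → let n = suc (m * 2) in CurvatureIndexIs (C n) ((n * n ∸ 1) // (4 * n))
C-curvatureIndex-1+2m zero    =
  curvatureIndexIs (Cycle.C-certificate 0) (Cycle.C-constInX 0) (inj₁ (one-vertex-distanceExceptional (adj (C 1))))
C-curvatureIndex-1+2m (suc m) =
  curvatureIndexIs C-certificate (subst (ConstInX (C n)) value C-constInX) (inj₂ (//≢0 (n * n ∸ 1) (4 * n)))
  where
  n = suc (suc m * 2)
  open Cycle (suc m * 2)
  value : + cycleDistSum n / n ≡ (n * n ∸ 1) // (4 * n)
  value = trans (sym (ℚP.*-identityˡ (+ cycleDistSum n / n)))
                (trans (scaledCycleIndex-odd 1 (suc m)) (cong (_// (4 * n)) (ℕP.*-identityˡ (n * n ∸ 1))))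

C-curvatureIndex-odd : ∀ n → ¬ 2 ∣ n → CurvatureIndexIs (C n) ((n * n ∸ 1) // (4 * n))
C-curvatureIndex-odd n 2∤n = let (m , n≡1+2m) = ¬2∣⇒odd n 2∤n in
  subst (λ n → CurvatureIndexIs (C n) ((n * n ∸ 1) // (4 * n))) (sym n≡1+2m) (C-curvatureIndex-1+2m m)

torus-curvatureIndex-even : ∀ n d → 2 ≤ n → 1 ≤ d → 2 ∣ n → CurvatureIndexIs (C n ^□ d) ((d * n) // 4)
torus-curvatureIndex-even (suc k) (suc d) _ _ (divides m 1+k≡2m) =
  curvatureIndexIs (^□-certificate C-certificate (suc d))
    (subst (ConstInX (C (suc k) ^□ suc d)) (scaledCycleIndex-even (suc d) k m 1+k≡2m)
           (constInX-^□ C-certificate C-constInX (suc d)))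
    (inj₂ (//≢0 (suc d * suc k) 4))
  where open Cycle k

torus-curvatureIndex-1+2m : ∀ d m → let n = suc (m * 2) in
                            2 ≤ n → CurvatureIndexIs (C n ^□ suc d) ((suc d * (n * n ∸ 1)) // (4 * n))
torus-curvatureIndex-1+2m d zero    (s≤s ())
torus-curvatureIndex-1+2m d (suc m) _ =
  curvatureIndexIs (^□-certificate C-certificate (suc d))
    (subst (ConstInX (C n ^□ suc d)) (scaledCycleIndex-odd (suc d) (suc m))
           (constInX-^□ C-certificate C-constInX (suc d)))
    (inj₂ (//≢0 (suc d * (n * n ∸ 1)) (4 * n)))
  where
  n = suc (suc m * 2)
  open Cycle (suc m * 2)

torus-curvatureIndex-odd : ∀ n d → 2 ≤ n → 1 ≤ d → ¬ 2 ∣ n → CurvatureIndexIs (C n ^□ d) ((d * (n * n ∸ 1)) // (4 * n))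
torus-curvatureIndex-odd n (suc d) 2≤n _ 2∤n = let (m , n≡1+2m) = ¬2∣⇒odd n 2∤n in
  subst (λ n → CurvatureIndexIs (C n ^□ suc d) ((suc d * (n * n ∸ 1)) // (4 * n))) (sym n≡1+2m)
        (torus-curvatureIndex-1+2m d m (subst (2 ≤_) n≡1+2m 2≤n))

Q-curvatureIndex : ∀ d → 2 ≤ d → CurvatureIndexIs (Q d) (d // 2)
Q-curvatureIndex (suc zero)      (s≤s ())
Q-curvatureIndex d@(suc (suc _)) _ =
  curvatureIndexIs (^□-certificate (K-certificate 2) d)
    (subst (ConstInX (Q d)) (trans (fromℕ-*-/ d 1 1) (cong (λ a → + a / 2) (ℕP.*-identityʳ d)))
           (constInX-^□ (K-certificate 2) (K-constInX 1) d))
    (inj₂ (//≢0 d 2))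

grid-curvatureIndex : ∀ n m → 1 ≤ n → 1 ≤ m → CurvatureIndexIs (P n □ P m) (((n ∸ 1) // 2) +ℚ ((m ∸ 1) // 2))
grid-curvatureIndex (suc a) (suc b) _ _ =
  curvatureIndexIs (□-certificate (P-certificate (suc a)) (P-certificate (suc b)))
    (constInX-□ (P-certificate (suc a)) (P-certificate (suc b)) (P-constInX a) (P-constInX b))
    (exceptional⊎nonzero a b)
  where
  exceptional⊎nonzero : ∀ a b → DistanceExceptional (P (suc a) □ P (suc b)) ⊎ (+ a / 2 ℚ.+ + b / 2 ≢ 0ℚ)
  exceptional⊎nonzero zero    zero    = inj₁ (one-vertex-distanceExceptional (adj (P 1 □ P 1)))
  exceptional⊎nonzero (suc a) b       = inj₂ (λ eq → //≢0 (suc a * 2 ℕ.+ b * 2) 4 (trans (sym (/-+-/ (suc a) 1 b 1)) eq))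
  exceptional⊎nonzero zero    (suc b) = inj₂ (λ eq → //≢0 (suc b * 2) 4 (trans (sym (/-+-/ 0 1 (suc b) 1)) eq))

K-curvatureIndex : ∀ n → 1 ≤ n → CurvatureIndexIs (K n) ((n ∸ 1) // n)
K-curvatureIndex (suc zero)    _ =
  curvatureIndexIs (K-certificate 1) (K-constInX 0) (inj₁ (one-vertex-distanceExceptional (adj (K 1))))
K-curvatureIndex (suc (suc k)) _ =
  curvatureIndexIs (K-certificate (suc (suc k))) (K-constInX (suc k)) (inj₂ (//≢0 (suc k) (suc (suc k))))

theorem4p2 :
    -- (i) cycles
    (∀ (n : ℕ) → 1 ≤ n →
        (2 ∣ n → CurvatureIndexIs (C n) (n // 4))
      × (¬ 2 ∣ n → CurvatureIndexIs (C n) ((n * n ∸ 1) // (4 * n))))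
    -- (ii) tori
    × (∀ (n d : ℕ) → 2 ≤ n → 1 ≤ d →
        (2 ∣ n → CurvatureIndexIs (C n ^□ d) ((d * n) // 4))
      × (¬ 2 ∣ n → CurvatureIndexIs (C n ^□ d) ((d * (n * n ∸ 1)) // (4 * n))))
    -- (iii) hypercubes
    × (∀ (d : ℕ) → 2 ≤ d → CurvatureIndexIs (Q d) (d // 2))
    -- (iv) rectangular lattices
    × (∀ (n m : ℕ) → 1 ≤ n → 1 ≤ m →
        CurvatureIndexIs (P n □ P m) (((n ∸ 1) // 2) +ℚ ((m ∸ 1) // 2)))
    -- (v) complete graphs
    × (∀ (n : ℕ) → 1 ≤ n → CurvatureIndexIs (K n) ((n ∸ 1) // n))
theorem4p2 =
    (λ n 1≤n → C-curvatureIndex-even n 1≤n , C-curvatureIndex-odd n)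
  , (λ n d 2≤n 1≤d → torus-curvatureIndex-even n d 2≤n 1≤d , torus-curvatureIndex-odd n d 2≤n 1≤d)
  , Q-curvatureIndex
  , grid-curvatureIndex
  , K-curvatureIndex
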